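{- There exist non-complete regular graphs $G$ with arbitrarily large order and arbitrarily large regularity satisfying $\chi_{la}(G)=\chi(G)$; that is, for every $N$ there is a non-complete regular graph $G$ of order at least $N$ and regularity at least $N$ with $\chi_{la}(G)=\chi(G)$.
   Context: $\chi$ is the chromatic number. For a simple graph $G=(V,E)$ with $q$ edges, a bijection $f:E\to\{1,\dots,q\}$ is a local antimagic labeling if $f^+(u)\neq f^+(v)$ for every edge $uv$, where $f^+(u)=\sum_{e\ni u} f(e)$; the local antimagic chromatic number $\chi_{la}(G)$ is the minimum number of distinct values of $f^+$ over all local antimagic labelings of $G$. -}

module Defs where

open import Data.Nat using (ℕ; zero; suc; _+_; _<_; _≤_)
open import Data.Nat.Properties using (_<?_)
open import Data.Fin using (Fin; toℕ)
open import Data.Bool using (Bool; true; false; T; T?)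
open import Data.List using (List; map; length; deduplicate; filter)
open import Data.Nat.ListAction using (sum)
open import Data.List.Base using (allFin)
open import Data.Fin.Properties using (_≟_)
import Data.Nat.Properties as ℕP
open import Data.Product using (Σ; Σ-syntax; ∃; ∃-syntax; _×_; _,_)
open import Relation.Nullary using (¬_; yes; no)
open import Relation.Binary.PropositionalEquality using (_≡_; _≢_)
open import Function.Bundles using (_⤖_; Bijection)

record Graph (n : ℕ) : Set where
  field
    adj   : Fin n → Fin n → Bool
    sym   : ∀ u v → adj u v ≡ adj v u
    irrfl : ∀ u → adj u u ≡ false
open Graph public

adj-sym : ∀ {n} (G : Graph n) u v → T (adj G u v) → T (adj G v u)
adj-sym G u v p rewrite sym G u v = p

-- Edges: unordered pairs {i,j}, represented canonically by toℕ i < toℕ j.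
Edge : ∀ {n} → Graph n → Set
Edge {n} G = Σ[ i ∈ Fin n ] Σ[ j ∈ Fin n ] (toℕ i < toℕ j × T (adj G i j))

degree : ∀ {n} → Graph n → Fin n → ℕ
degree {n} G u = length (filter (λ v → T? (adj G u v)) (allFin n))

Regular : ∀ {n} → Graph n → ℕ → Set
Regular {n} G r = ∀ u → degree G u ≡ r

NonComplete : ∀ {n} → Graph n → Set
NonComplete {n} G = Σ[ u ∈ Fin n ] Σ[ v ∈ Fin n ] (u ≢ v × adj G u v ≡ false)

ProperColouring : ∀ {n} → Graph n → ℕ → Set
ProperColouring {n} G k =
  Σ[ c ∈ (Fin n → Fin k) ] (∀ u v → T (adj G u v) → c u ≢ c v)

IsMinimum : (ℕ → Set) → ℕ → Set
IsMinimum P k = P k × (∀ m → P m → k ≤ m)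

IsChromaticNumber : ∀ {n} → Graph n → ℕ → Set
IsChromaticNumber G k = IsMinimum (ProperColouring G) k

-- An edge labelling: a bijection E → {1,…,q}, encoded as E ⤖ Fin q
-- with the label of e being toℕ (f e) + 1.
Labelling : ∀ {n} → Graph n → ℕ → Set
Labelling G q = Edge G ⤖ Fin q

module _ {n : ℕ} (G : Graph n) {q : ℕ} (f : Labelling G q) where
  open Bijection f renaming (to to lab)

  labelOf : Edge G → ℕ
  labelOf e = suc (toℕ (lab e))

  contrib : Fin n → Fin n → ℕ
  contrib u v with T? (adj G u v) | toℕ u <? toℕ v | toℕ v <? toℕ u
  ... | no _  | _     | _     = 0
  ... | yes p | yes l | _     = labelOf (u , v , l , p)
  ... | yes p | no _  | yes l =
        labelOf (v , u , l , adj-sym G u v p)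
  ... | yes p | no _  | no _  = 0

  vsum : Fin n → ℕ
  vsum u = sum (map (contrib u) (allFin n))

IsLocalAntimagic : ∀ {n} (G : Graph n) {q} → Labelling G q → Set
IsLocalAntimagic {n} G f = ∀ u v → T (adj G u v) → vsum G f u ≢ vsum G f v

distinctValues : ∀ {n} → (Fin n → ℕ) → ℕ
distinctValues {n} g = length (deduplicate ℕP._≟_ (map g (allFin n)))

LAColours : ∀ {n} → Graph n → ℕ → Set
LAColours G k = Σ[ q ∈ ℕ ] Σ[ f ∈ Labelling G q ]
  (IsLocalAntimagic G f × distinctValues (vsum G f) ≡ k)

IsLocalAntimagicChromaticNumber : ∀ {n} → Graph n → ℕ → Set
IsLocalAntimagicChromaticNumber G k = IsMinimum (LAColours G) k

module Submission where

-- The witness is the complete 5-partite graph K(m,m,m,m,m): it is 4m-regular, a transversal is a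
-- 5-clique and the parts colour it properly, so χ = 5; a local antimagic labelling separates the
-- clique as well, so χ_la ≥ 5. For χ_la ≤ 5 the ten blocks of edges between two parts are numbered
-- b = 0,…,9 and block b receives the labels m²b+1,…,m²b+m², written into an m×m array row-wise or
-- column-wise, possibly in reverse order. The design is chosen so that at every part the four
-- incident blocks form two pairs that are read along the same side, one forwards and one reversed;
-- along each such pair the labels at a vertex add up to a constant. Hence every vertex sum depends
-- only on the part, through the sum of the block numbers at that part, which differs between parts.

open import Data.Bool using (Bool; true; false; T; T?; not)
open import Data.Bool.Properties using (T-irrelevant)
open import Data.Empty using (⊥-elim)
open import Data.Fin as F using (Fin; zero; suc; toℕ; combine; remQuot; opposite; _↑ˡ_; _↑ʳ_)
import Data.Fin.Properties as FP
open import Data.Fin.Patterns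
open import Data.List using (List; []; _∷_; map; length; filter; lookup; deduplicate; tabulate)
open import Data.List.Base using (allFin)
open import Data.List.Membership.Propositional using (_∈_)
open import Data.List.Membership.Propositional.Properties
  using (∈-lookup; ∈-map⁺; ∈-map⁻; ∈-allFin; ∈-deduplicate⁺; ∈-deduplicate⁻)
open import Data.List.Properties using (map-tabulate)
import Data.List.Relation.Unary.All as All
open import Data.List.Relation.Unary.AllPairs using (_∷_)
open import Data.List.Relation.Unary.Any as Any using ()
open import Data.List.Relation.Unary.Any.Properties using (lookup-index)
open import Data.List.Relation.Unary.Unique.DecPropositional.Properties using (deduplicate-!)
open import Data.List.Relation.Unary.Unique.Propositional using (Unique)
open import Data.Nat using (ℕ; zero; suc; _+_; _*_; _∸_; _≤_; _<_; NonZero)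
import Data.Nat.ListAction as List
import Data.Nat.Properties as ℕP
open import Algebra.Properties.Semiring.Sum ℕP.+-*-semiring
  using (sum; sum-syntax; sum-cong-≗; ∑-distrib-+; *-distribˡ-sum)
open import Data.Nat.Tactic.RingSolver using (solve-∀)
open import Data.Product using (Σ-syntax; _×_; _,_; proj₁; proj₂; swap; uncurry)
open import Data.Unit using (tt)
open import Function using (_∘_)
open import Function.Bundles using (_↔_; mk↔ₛ′)
open import Function.Construct.Composition using (_↔-∘_)
open import Function.Properties.Inverse using (↔⇒⤖)
open import Relation.Binary.Definitions using (tri<; tri≈; tri>)
open import Relation.Binary.PropositionalEquality
open import Relation.Nullary using (¬_; yes; no; does)
open import Relation.Nullary.Decidable using (True; toWitness; from-yes; dec-true; _×-dec_; _→-dec_)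

open import Defs hiding (sym)

sum-const : ∀ n c → ∑[ i < n ] c ≡ n * c
sum-const zero    c = refl
sum-const (suc n) c = cong (c +_) (sum-const n c)

sum-↑ : ∀ x y (f : Fin (x + y) → ℕ) →
        sum f ≡ ∑[ i < x ] f (i ↑ˡ y) + ∑[ j < y ] f (x ↑ʳ j)
sum-↑ zero    y f = refl
sum-↑ (suc x) y f = trans (cong (f zero +_) (sum-↑ x y (f ∘ suc))) (sym (ℕP.+-assoc (f zero) _ _))

sum-combine : ∀ a m (f : Fin (a * m) → ℕ) → sum f ≡ ∑[ p < a ] ∑[ j < m ] f (combine p j)
sum-combine zero    m f = refl
sum-combine (suc a) m f =
  trans (sum-↑ m (a * m) f) (cong (∑[ j < m ] f (j ↑ˡ (a * m)) +_) (sum-combine a m (f ∘ (m ↑ʳ_))))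

sum-tabulate : ∀ n (f : Fin n → ℕ) → List.sum (tabulate f) ≡ sum f
sum-tabulate zero    f = refl
sum-tabulate (suc n) f = cong (f zero +_) (sum-tabulate n (f ∘ suc))

sum-allFin : ∀ n (f : Fin n → ℕ) → List.sum (map f (allFin n)) ≡ sum f
sum-allFin n f = trans (cong List.sum (map-tabulate (λ i → i) f)) (sum-tabulate n f)

indicator : Bool → ℕ
indicator true  = 1
indicator false = 0

length-filter-T : ∀ {A : Set} (g : A → Bool) xs →
                  length (filter (T? ∘ g) xs) ≡ List.sum (map (indicator ∘ g) xs)
length-filter-T g []       = refl
length-filter-T g (x ∷ xs) with g x
... | true  = cong suc (length-filter-T g xs)
... | false = length-filter-T g xs

degree-sum : ∀ {n} (G : Graph n) u → degree G u ≡ ∑[ v < n ] indicator (adj G u v)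
degree-sum {n} G u = trans (length-filter-T (adj G u) (allFin n)) (sum-allFin n _)

vsum-sum : ∀ {n} (G : Graph n) {q} (f : Labelling G q) u → vsum G f u ≡ ∑[ v < n ] contrib G f u v
vsum-sum {n} G f u = sum-allFin n (contrib G f u)

toℕ-opposite-complement : ∀ {n} x y (r : Fin n) →
  suc (n * x + toℕ r) + suc (n * y + toℕ (opposite r)) ≡ suc (n * suc (x + y))
toℕ-opposite-complement {n} x y r rewrite FP.opposite-prop r =
  go (toℕ r) (n ∸ suc (toℕ r)) (ℕP.m+[n∸m]≡n (FP.toℕ<n r))
  where
  go : ∀ t t′ → suc t + t′ ≡ n → suc (n * x + t) + suc (n * y + t′) ≡ suc (n * suc (x + y))
  go t t′ refl = identity t t′ x y
    where
    identity : ∀ t t′ x y → let n = suc t + t′ in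
               suc (n * x + t) + suc (n * y + t′) ≡ suc (n * suc (x + y))
    identity = solve-∀

lookup-injective : ∀ {A : Set} (ys : List A) → Unique ys → ∀ i j → lookup ys i ≡ lookup ys j → i ≡ j
lookup-injective (y ∷ ys) _         zero    zero    _  = refl
lookup-injective (y ∷ ys) (y∉ ∷ _)  zero    (suc j) eq = ⊥-elim (All.lookup y∉ (∈-lookup j) eq)
lookup-injective (y ∷ ys) (y∉ ∷ _)  (suc i) zero    eq = ⊥-elim (All.lookup y∉ (∈-lookup i) (sym eq))
lookup-injective (y ∷ ys) (_  ∷ u)  (suc i) (suc j) eq = cong suc (lookup-injective ys u i j eq)

module _ {n : ℕ} (g : Fin n → ℕ) where

  private
    values : List ℕ
    values = deduplicate ℕP._≟_ (map g (allFin n))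

  distinctValues-≥ : ∀ {k} (c : Fin k → Fin n) →
                     (∀ a b → g (c a) ≡ g (c b) → a ≡ b) → k ≤ distinctValues g
  distinctValues-≥ c inj = FP.injective⇒≤ {f = Any.index ∘ mem} λ {a} {b} eq →
    inj a b (trans (lookup-index (mem a)) (trans (cong (lookup values) eq) (sym (lookup-index (mem b)))))
    where
    mem : ∀ a → g (c a) ∈ values
    mem a = ∈-deduplicate⁺ ℕP._≟_ (∈-map⁺ g (∈-allFin (c a)))

  distinctValues-≤ : ∀ {k} (π : Fin n → Fin k) (h : Fin k → ℕ) →
                     (∀ u → g u ≡ h (π u)) → distinctValues g ≤ k
  distinctValues-≤ π h g≡h∘π = FP.injective⇒≤ {f = π ∘ witness} λ {i} {j} eq →
    lookup-injective values (deduplicate-! ℕP._≟_ (map g (allFin n))) i j (begin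
      lookup values i       ≡⟨ value i ⟩
      g (witness i)         ≡⟨ g≡h∘π (witness i) ⟩
      h (π (witness i))     ≡⟨ cong h eq ⟩
      h (π (witness j))     ≡⟨ sym (g≡h∘π (witness j)) ⟩
      g (witness j)         ≡⟨ sym (value j) ⟩
      lookup values j       ∎)
    where
    open ≡-Reasoning
    preimage : ∀ i → Σ[ u ∈ Fin n ] (_ × lookup values i ≡ g u)
    preimage i = ∈-map⁻ g (∈-deduplicate⁻ ℕP._≟_ (map g (allFin n)) (∈-lookup i))
    witness : Fin (length values) → Fin n
    witness i = proj₁ (preimage i)
    value : ∀ i → lookup values i ≡ g (witness i)
    value i = proj₂ (proj₂ (preimage i))

module _ {n : ℕ} (G : Graph n) where

  IsClique : ∀ {k} → (Fin k → Fin n) → Set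
  IsClique c = ∀ a b → a ≢ b → T (adj G (c a) (c b))

  ProperOn : ∀ {A : Set} → (Fin n → A) → Set
  ProperOn g = ∀ u v → T (adj G u v) → g u ≢ g v

  clique-injective : ∀ {k} {A : Set} {c : Fin k → Fin n} {g : Fin n → A} →
                     IsClique c → ProperOn g → ∀ a b → g (c a) ≡ g (c b) → a ≡ b
  clique-injective {c = c} {g} clique proper a b eq with a FP.≟ b
  ... | yes a≡b = a≡b
  ... | no  a≢b = ⊥-elim (proper (c a) (c b) (clique a b a≢b) eq)

  isChromaticNumber : ∀ {k} (c : Fin k → Fin n) → IsClique c →
                      (col : Fin n → Fin k) → ProperOn col → IsChromaticNumber G k
  isChromaticNumber c clique col proper =
    (col , proper) ,
    λ k′ (col′ , proper′) → FP.injective⇒≤ (clique-injective clique proper′ _ _)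

  isLocalAntimagicChromaticNumber :
    ∀ {k q} (c : Fin k → Fin n) → IsClique c →
    (f : Labelling G q) → IsLocalAntimagic G f →
    (π : Fin n → Fin k) (h : Fin k → ℕ) → (∀ u → vsum G f u ≡ h (π u)) →
    IsLocalAntimagicChromaticNumber G k
  isLocalAntimagicChromaticNumber c clique f antimagic π h factor =
    (_ , f , antimagic , ℕP.≤-antisym (distinctValues-≤ (vsum G f) π h factor)
                                        (distinctValues-≥ (vsum G f) c (clique-injective clique antimagic))) ,
    λ k′ (_ , f′ , antimagic′ , k′≡) →
      subst (_ ≤_) k′≡ (distinctValues-≥ (vsum G f′) c (clique-injective clique antimagic′))

edge-≡ : ∀ {n} (G : Graph n) {u v u′ v′} {l a l′ a′} → u ≡ u′ → v ≡ v′ →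
         _≡_ {A = Edge G} (u , v , l , a) (u′ , v′ , l′ , a′)
edge-≡ G {u} {v} {l = l} {a} {l′} {a′} refl refl =
  cong₂ (λ l a → u , v , l , a) (ℕP.<-irrelevant l l′) (T-irrelevant a a′)

module _ {n : ℕ} (G : Graph n) {q : ℕ} (f : Labelling G q) where

  contrib-¬adj : ∀ u v → ¬ T (adj G u v) → contrib G f u v ≡ 0
  contrib-¬adj u v ¬a with T? (adj G u v) | toℕ u ℕP.<? toℕ v | toℕ v ℕP.<? toℕ u
  ... | no  _ | _ | _ = refl
  ... | yes a | _ | _ = ⊥-elim (¬a a)

  contrib-< : ∀ u v (l : toℕ u < toℕ v) (a : T (adj G u v)) →
              contrib G f u v ≡ labelOf G f (u , v , l , a)
  contrib-< u v l a with T? (adj G u v) | toℕ u ℕP.<? toℕ v | toℕ v ℕP.<? toℕ u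
  ... | no ¬a | _     | _ = ⊥-elim (¬a a)
  ... | yes _ | yes _ | _ = cong (labelOf G f) (edge-≡ G refl refl)
  ... | yes _ | no ¬l | _ = ⊥-elim (¬l l)

  contrib-> : ∀ u v (l : toℕ v < toℕ u) (a : T (adj G u v)) →
              contrib G f u v ≡ labelOf G f (v , u , l , adj-sym G u v a)
  contrib-> u v l a with T? (adj G u v) | toℕ u ℕP.<? toℕ v | toℕ v ℕP.<? toℕ u
  ... | no ¬a | _     | _     = ⊥-elim (¬a a)
  ... | yes _ | yes l′ | _    = ⊥-elim (ℕP.<-asym l l′)
  ... | yes _ | no _  | yes _ = cong (labelOf G f) (edge-≡ G refl refl)
  ... | yes _ | no _  | no ¬l = ⊥-elim (¬l l)

count-≢ : ∀ {a} (p : Fin a) → ∑[ p′ < a ] indicator (not (does (p FP.≟ p′))) ≡ a ∸ 1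
count-≢ {suc a} zero    = trans (sum-const a 1) (ℕP.*-identityʳ a)
count-≢ {suc a} (suc p) = trans (cong suc (count-≢ p)) (ℕP.suc-pred a ⦃ FP.nonZeroIndex p ⦄)

OrderedPair : ℕ → Set
OrderedPair a = Σ[ p ∈ Fin a ] Σ[ p′ ∈ Fin a ] p F.< p′

orderedPair-≡ : ∀ {a} {p p′ r r′ : Fin a} {l l′} → p ≡ r → p′ ≡ r′ →
                _≡_ {A = OrderedPair a} (p , p′ , l) (r , r′ , l′)
orderedPair-≡ {l = l} {l′} refl refl = cong (λ l → _ , _ , l) (FP.<-irrelevant l l′)

module CompleteMultipartite (a m : ℕ) where

  part : Fin (a * m) → Fin a
  part u = proj₁ (remQuot {a} m u)

  index : Fin (a * m) → Fin m
  index u = proj₂ (remQuot {a} m u)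

  part-combine : ∀ p i → part (combine p i) ≡ p
  part-combine p i = cong proj₁ (FP.remQuot-combine {a} {m} p i)

  index-combine : ∀ p i → index (combine p i) ≡ i
  index-combine p i = cong proj₂ (FP.remQuot-combine {a} {m} p i)

  combine-part-index : ∀ u → combine (part u) (index u) ≡ u
  combine-part-index u = FP.combine-remQuot {a} m u

  adjacent : Fin (a * m) → Fin (a * m) → Bool
  adjacent u v = not (does (part u FP.≟ part v))

  adjacent⇒≢ : ∀ u v → T (adjacent u v) → part u ≢ part v
  adjacent⇒≢ u v adj with part u FP.≟ part v
  ... | no part≢ = part≢

  ≢⇒adjacent : ∀ u v → part u ≢ part v → T (adjacent u v)
  ≢⇒adjacent u v part≢ with part u FP.≟ part v
  ... | yes part≡ = part≢ part≡
  ... | no  _     = tt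

  ≡⇒¬adjacent : ∀ u v → part u ≡ part v → ¬ T (adjacent u v)
  ≡⇒¬adjacent u v part≡ adj = adjacent⇒≢ u v adj part≡

  adjacent-sym : ∀ u v → adjacent u v ≡ adjacent v u
  adjacent-sym u v with part u FP.≟ part v | part v FP.≟ part u
  ... | yes _  | yes _   = refl
  ... | no  _  | no  _   = refl
  ... | yes eq | no  ¬eq = ⊥-elim (¬eq (sym eq))
  ... | no ¬eq | yes eq  = ⊥-elim (¬eq (sym eq))

  adjacent-irrefl : ∀ u → adjacent u u ≡ false
  adjacent-irrefl u with part u FP.≟ part u
  ... | yes _    = refl
  ... | no  ¬eq  = ⊥-elim (¬eq refl)

  graph : Graph (a * m)
  graph = record { adj = adjacent ; sym = adjacent-sym ; irrfl = adjacent-irrefl }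

  adjacent-combine : ∀ p i p′ j → adjacent (combine p i) (combine p′ j) ≡ not (does (p FP.≟ p′))
  adjacent-combine p i p′ j rewrite part-combine p i | part-combine p′ j = refl

  adjacent-combine-≢ : ∀ {p p′} i j → p ≢ p′ → T (adjacent (combine p i) (combine p′ j))
  adjacent-combine-≢ {p} {p′} i j p≢p′ = ≢⇒adjacent (combine p i) (combine p′ j)
    (λ eq → p≢p′ (trans (sym (part-combine p i)) (trans eq (part-combine p′ j))))

  degree-combine : ∀ p i → degree graph (combine p i) ≡ m * (a ∸ 1)
  degree-combine p i = begin
    degree graph (combine p i)
      ≡⟨ degree-sum graph (combine p i) ⟩
    ∑[ v < a * m ] indicator (adjacent (combine p i) v)
      ≡⟨ sum-combine a m _ ⟩
    ∑[ p′ < a ] ∑[ j < m ] indicator (adjacent (combine p i) (combine p′ j))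
      ≡⟨ sum-cong-≗ (λ p′ → trans (sum-cong-≗ (λ j → cong indicator (adjacent-combine p i p′ j)))
                                  (sum-const m _)) ⟩
    ∑[ p′ < a ] (m * indicator (not (does (p FP.≟ p′))))
      ≡⟨ sym (*-distribˡ-sum {a} m _) ⟩
    m * ∑[ p′ < a ] indicator (not (does (p FP.≟ p′)))
      ≡⟨ cong (m *_) (count-≢ p) ⟩
    m * (a ∸ 1) ∎
    where open ≡-Reasoning

  regular : Regular graph (m * (a ∸ 1))
  regular u = trans (cong (degree graph) (sym (combine-part-index u)))
                    (degree-combine (part u) (index u))

  nonComplete : Fin a → (i j : Fin m) → i ≢ j → NonComplete graph
  nonComplete p i j i≢j =
    combine p i , combine p j ,
    (λ eq → i≢j (FP.combine-injectiveʳ p i p j eq)) ,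
    trans (adjacent-combine p i p j) (cong not (dec-true (p FP.≟ p) refl))

  transversal : Fin m → Fin a → Fin (a * m)
  transversal i p = combine p i

  transversal-isClique : ∀ i → IsClique graph (transversal i)
  transversal-isClique i p p′ = adjacent-combine-≢ i i

  part-proper : ProperOn graph part
  part-proper = adjacent⇒≢

  part-< : ∀ u v → toℕ u < toℕ v → T (adjacent u v) → part u F.< part v
  part-< u v u<v adj with FP.<-cmp (part u) (part v)
  ... | tri< lt _ _ = lt
  ... | tri≈ _ eq _ = ⊥-elim (adjacent⇒≢ u v adj eq)
  ... | tri> _ _ gt = ⊥-elim (ℕP.<-asym u<v
    (subst₂ F._<_ (combine-part-index v) (combine-part-index u) (FP.combine-monoˡ-< (index v) (index u) gt)))

  edge : OrderedPair a × Fin m × Fin m → Edge graph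
  edge ((p , p′ , p<p′) , i , j) =
    combine p i , combine p′ j , FP.combine-monoˡ-< i j p<p′ , adjacent-combine-≢ i j (FP.<⇒≢ p<p′)

  edges : Edge graph ↔ (OrderedPair a × Fin m × Fin m)
  edges = mk↔ₛ′ coords edge coords-edge edge-coords
    where
    coords : Edge graph → OrderedPair a × Fin m × Fin m
    coords (u , v , u<v , adj) = (part u , part v , part-< u v u<v adj) , index u , index v
    coords-edge : ∀ x → coords (edge x) ≡ x
    coords-edge ((p , p′ , _) , i , j) =
      cong₂ _,_ (orderedPair-≡ (part-combine p i) (part-combine p′ j))
                (cong₂ _,_ (index-combine p i) (index-combine p′ j))
    edge-coords : ∀ e → edge (coords e) ≡ e
    edge-coords (u , v , _ , _) = edge-≡ graph (combine-part-index u) (combine-part-index v)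

orderedPair : (p p′ : Fin 5) → {True (p FP.<? p′)} → OrderedPair 5
orderedPair p p′ {p<p′} = p , p′ , toWitness p<p′

pairOf : Fin 10 → OrderedPair 5
pairOf 0F = orderedPair 0F 1F
pairOf 1F = orderedPair 1F 2F
pairOf 2F = orderedPair 2F 3F
pairOf 3F = orderedPair 3F 4F
pairOf 4F = orderedPair 0F 4F
pairOf 5F = orderedPair 0F 2F
pairOf 6F = orderedPair 1F 3F
pairOf 7F = orderedPair 2F 4F
pairOf 8F = orderedPair 0F 3F
pairOf 9F = orderedPair 1F 4F

block : Fin 5 → Fin 5 → Fin 10
block 0F 1F = 0F
block 1F 2F = 1F
block 2F 3F = 2F
block 3F 4F = 3F
block 0F 4F = 4F
block 0F 2F = 5F
block 1F 3F = 6F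
block 2F 4F = 7F
block 0F 3F = 8F
block 1F 4F = 9F
block _  _  = 0F

blockOf : OrderedPair 5 → Fin 10
blockOf (p , p′ , _) = block p p′

blockOf-pairOf : ∀ b → blockOf (pairOf b) ≡ b
blockOf-pairOf = from-yes (FP.all? λ b → blockOf (pairOf b) FP.≟ b)

pairOf-blockOf : ∀ e → pairOf (blockOf e) ≡ e
pairOf-blockOf (p , p′ , p<p′) = orderedPair-≡ (proj₁ (ends p p′ p<p′)) (proj₂ (ends p p′ p<p′))
  where
  ends : ∀ p p′ → p F.< p′ →
         proj₁ (pairOf (block p p′)) ≡ p × proj₁ (proj₂ (pairOf (block p p′))) ≡ p′
  ends = from-yes (FP.all? λ p → FP.all? λ p′ → p FP.<? p′ →-dec
           (proj₁ (pairOf (block p p′)) FP.≟ p ×-dec proj₁ (proj₂ (pairOf (block p p′))) FP.≟ p′))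

data Side : Set where
  row col : Side

other : Side → Side
other row = col
other col = row

side : Fin 10 → Side
side 4F = col
side 8F = col
side 9F = col
side _  = row

reflected : Fin 10 → Bool
reflected 5F = true
reflected 6F = true
reflected 7F = true
reflected 8F = true
reflected 9F = true
reflected _  = false

incidence : Fin 5 → Fin 5 → Fin 10 × Side
incidence p p′ with FP.<-cmp p p′
... | tri< _ _ _ = block p p′ , side (block p p′)
... | tri≈ _ _ _ = 0F , row    -- junk: no block joins a part to itself
... | tri> _ _ _ = block p′ p , other (side (block p′ p))

Complementary : Fin 5 → Fin 5 → Fin 5 → Set
Complementary p p₁ p₂ =
  p ≢ p₁ × p ≢ p₂ × proj₂ (incidence p p₁) ≡ proj₂ (incidence p p₂) ×
  reflected (proj₁ (incidence p p₁)) ≡ false × reflected (proj₁ (incidence p p₂)) ≡ true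

record Pairing (p : Fin 5) : Set where
  constructor pairing
  field
    p₁ p₂ p₃ p₄       : Fin 5
    complementary₁₂ : Complementary p p₁ p₂
    complementary₃₄ : Complementary p p₃ p₄

pairingAt : ∀ p → Pairing p
pairingAt 0F = pairing 1F 2F 4F 3F ((λ ()) , (λ ()) , refl , refl , refl) ((λ ()) , (λ ()) , refl , refl , refl)
pairingAt 1F = pairing 0F 4F 2F 3F ((λ ()) , (λ ()) , refl , refl , refl) ((λ ()) , (λ ()) , refl , refl , refl)
pairingAt 2F = pairing 1F 0F 3F 4F ((λ ()) , (λ ()) , refl , refl , refl) ((λ ()) , (λ ()) , refl , refl , refl)
pairingAt 3F = pairing 2F 1F 4F 0F ((λ ()) , (λ ()) , refl , refl , refl) ((λ ()) , (λ ()) , refl , refl , refl)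
pairingAt 4F = pairing 0F 1F 3F 2F ((λ ()) , (λ ()) , refl , refl , refl) ((λ ()) , (λ ()) , refl , refl , refl)

sum-pairing : ∀ p (f : Fin 5 → ℕ) → let open Pairing (pairingAt p) in
              ∑[ p′ < 5 ] f p′ ≡ f p + ((f p₁ + f p₂) + (f p₃ + f p₄))
sum-pairing 0F f = rearrange (f 0F) (f 1F) (f 2F) (f 3F) (f 4F)
  where
  rearrange : ∀ a b c d e → a + (b + (c + (d + (e + 0)))) ≡ a + ((b + c) + (e + d))
  rearrange = solve-∀
sum-pairing 1F f = rearrange (f 0F) (f 1F) (f 2F) (f 3F) (f 4F)
  where
  rearrange : ∀ a b c d e → a + (b + (c + (d + (e + 0)))) ≡ b + ((a + e) + (c + d))
  rearrange = solve-∀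
sum-pairing 2F f = rearrange (f 0F) (f 1F) (f 2F) (f 3F) (f 4F)
  where
  rearrange : ∀ a b c d e → a + (b + (c + (d + (e + 0)))) ≡ c + ((b + a) + (d + e))
  rearrange = solve-∀
sum-pairing 3F f = rearrange (f 0F) (f 1F) (f 2F) (f 3F) (f 4F)
  where
  rearrange : ∀ a b c d e → a + (b + (c + (d + (e + 0)))) ≡ d + ((c + b) + (e + a))
  rearrange = solve-∀
sum-pairing 4F f = rearrange (f 0F) (f 1F) (f 2F) (f 3F) (f 4F)
  where
  rearrange : ∀ a b c d e → a + (b + (c + (d + (e + 0)))) ≡ e + ((a + b) + (d + c))
  rearrange = solve-∀

level : Fin 5 → ℕ
level p = (toℕ (blockAt p₁) + toℕ (blockAt p₂)) + (toℕ (blockAt p₃) + toℕ (blockAt p₄))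
  where
  open Pairing (pairingAt p)
  blockAt : Fin 5 → Fin 10
  blockAt p′ = proj₁ (incidence p p′)

level-injective : ∀ p p′ → level p ≡ level p′ → p ≡ p′
level-injective = from-yes (FP.all? λ p → FP.all? λ p′ → level p ℕP.≟ level p′ →-dec p FP.≟ p′)

module Cells (m : ℕ) where

  cell : Side → Fin m → Fin m → Fin (m * m)
  cell row i j = combine i j
  cell col i j = combine j i

  uncell : Side → Fin (m * m) → Fin m × Fin m
  uncell row r = remQuot m r
  uncell col r = swap (remQuot m r)

  cell-uncell : ∀ s r → cell s (proj₁ (uncell s r)) (proj₂ (uncell s r)) ≡ r
  cell-uncell row r = FP.combine-remQuot {m} m r
  cell-uncell col r = FP.combine-remQuot {m} m r

  uncell-cell : ∀ s i j → uncell s (cell s i j) ≡ (i , j)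
  uncell-cell row i j = FP.remQuot-combine i j
  uncell-cell col i j = cong swap (FP.remQuot-combine j i)

  cell-other : ∀ s i j → cell s j i ≡ cell (other s) i j
  cell-other row i j = refl
  cell-other col i j = refl

  reflectIf : Bool → Fin (m * m) → Fin (m * m)
  reflectIf false r = r
  reflectIf true  r = opposite r

  reflectIf-involutive : ∀ b r → reflectIf b (reflectIf b r) ≡ r
  reflectIf-involutive false r = refl
  reflectIf-involutive true  r = FP.opposite-involutive r

module FivePartite (m : ℕ) where

  open CompleteMultipartite 5 m
  open Cells m

  position : Fin 10 → Fin m → Fin m → Fin (m * m)
  position b i j = reflectIf (reflected b) (cell (side b) i j)

  unposition : Fin 10 → Fin (m * m) → Fin m × Fin m
  unposition b r = uncell (side b) (reflectIf (reflected b) r)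

  position-unposition : ∀ b r → position b (proj₁ (unposition b r)) (proj₂ (unposition b r)) ≡ r
  position-unposition b r = begin
    reflectIf (reflected b) (cell (side b) _ _)      ≡⟨ cong (reflectIf (reflected b)) (cell-uncell (side b) _) ⟩
    reflectIf (reflected b) (reflectIf (reflected b) r) ≡⟨ reflectIf-involutive (reflected b) r ⟩
    r                                                ∎
    where open ≡-Reasoning

  unposition-position : ∀ b i j → unposition b (position b i j) ≡ (i , j)
  unposition-position b i j = begin
    uncell (side b) (reflectIf (reflected b) (reflectIf (reflected b) (cell (side b) i j)))
      ≡⟨ cong (uncell (side b)) (reflectIf-involutive (reflected b) _) ⟩
    uncell (side b) (cell (side b) i j)
      ≡⟨ uncell-cell (side b) i j ⟩
    (i , j) ∎
    where open ≡-Reasoning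

  labels : (OrderedPair 5 × Fin m × Fin m) ↔ Fin (10 * (m * m))
  labels = mk↔ₛ′ label unlabel label-unlabel unlabel-label
    where
    label : OrderedPair 5 × Fin m × Fin m → Fin (10 * (m * m))
    label (e , i , j) = combine (blockOf e) (position (blockOf e) i j)

    unlabel : Fin (10 * (m * m)) → OrderedPair 5 × Fin m × Fin m
    unlabel x = uncurry (λ b r → pairOf b , unposition b r) (remQuot {10} (m * m) x)

    label-unlabel : ∀ x → label (unlabel x) ≡ x
    label-unlabel x = begin
      combine (blockOf (pairOf b)) (position (blockOf (pairOf b)) i j)
        ≡⟨ cong (λ b′ → combine b′ (position b′ i j)) (blockOf-pairOf b) ⟩
      combine b (position b i j)
        ≡⟨ cong (combine b) (position-unposition b r) ⟩
      combine b r
        ≡⟨ FP.combine-remQuot {10} (m * m) x ⟩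
      x ∎
      where
      open ≡-Reasoning
      b : Fin 10
      b = proj₁ (remQuot {10} (m * m) x)
      r : Fin (m * m)
      r = proj₂ (remQuot {10} (m * m) x)
      i j : Fin m
      i = proj₁ (unposition b r)
      j = proj₂ (unposition b r)

    unlabel-label : ∀ y → unlabel (label y) ≡ y
    unlabel-label (e , i , j) = begin
      unlabel (combine b (position b i j))
        ≡⟨ cong (uncurry (λ b r → pairOf b , unposition b r)) (FP.remQuot-combine b (position b i j)) ⟩
      pairOf b , unposition b (position b i j)
        ≡⟨ cong₂ _,_ (pairOf-blockOf e) (unposition-position b i j) ⟩
      e , i , j ∎
      where
      open ≡-Reasoning
      b : Fin 10
      b = blockOf e

  -- Kept abstract so that the type checker never unfolds remQuot inside the labels.
  abstract
    labelling : Labelling graph (10 * (m * m))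
    labelling = ↔⇒⤖ (labels ↔-∘ edges)

    labelOf-edge : ∀ e i j →
      labelOf graph labelling (edge (e , i , j)) ≡ suc (m * m * toℕ (blockOf e) + toℕ (position (blockOf e) i j))
    labelOf-edge (p , p′ , _) i j
      rewrite part-combine p i | part-combine p′ j | index-combine p i | index-combine p′ j =
      cong suc (FP.toℕ-combine (block p p′) _)

  partSum : Fin 5 → Fin m → Fin 5 → ℕ
  partSum p i p′ = ∑[ j < m ] contrib graph labelling (combine p i) (combine p′ j)

  incidentSum : Fin 10 → Side → Fin m → ℕ
  incidentSum b s i = ∑[ j < m ] suc (m * m * toℕ b + toℕ (reflectIf (reflected b) (cell s i j)))

  partSum-≢ : ∀ p p′ i → p ≢ p′ → partSum p i p′ ≡ uncurry incidentSum (incidence p p′) i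
  partSum-≢ p p′ i p≢p′ with FP.<-cmp p p′
  ... | tri< p<p′ _ _ = sum-cong-≗ λ j →
    trans (contrib-< graph labelling _ _ _ _) (labelOf-edge (p , p′ , p<p′) i j)
  ... | tri≈ _ p≡p′ _ = ⊥-elim (p≢p′ p≡p′)
  ... | tri> _ _ p′<p = sum-cong-≗ λ j → begin
    contrib graph labelling (combine p i) (combine p′ j)
      ≡⟨ contrib-> graph labelling _ _ (FP.combine-monoˡ-< j i p′<p)
                                       (adjacent-combine-≢ i j (FP.<⇒≢ p′<p ∘ sym)) ⟩
    labelOf graph labelling (combine p′ j , combine p i , _ , _)
      ≡⟨ cong (labelOf graph labelling) (edge-≡ graph refl refl) ⟩
    labelOf graph labelling (edge ((p′ , p , p′<p) , j , i))
      ≡⟨ labelOf-edge (p′ , p , p′<p) j i ⟩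
    suc (m * m * toℕ b + toℕ (reflectIf (reflected b) (cell (side b) j i)))
      ≡⟨ cong (λ c → suc (m * m * toℕ b + toℕ (reflectIf (reflected b) c))) (cell-other (side b) i j) ⟩
    suc (m * m * toℕ b + toℕ (reflectIf (reflected b) (cell (other (side b)) i j))) ∎
    where
    open ≡-Reasoning
    b : Fin 10
    b = block p′ p

  partSum-self : ∀ p i → partSum p i p ≡ 0
  partSum-self p i = trans
    (sum-cong-≗ λ j → contrib-¬adj graph labelling _ _
       (≡⇒¬adjacent _ _ (trans (part-combine p i) (sym (part-combine p j)))))
    (trans (sum-const m 0) (ℕP.*-zeroʳ m))

  incidentSum-complement : ∀ b b′ s i → reflected b ≡ false → reflected b′ ≡ true →
    incidentSum b s i + incidentSum b′ s i ≡ m * suc (m * m * suc (toℕ b + toℕ b′))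
  incidentSum-complement b b′ s i plain flipped = begin
    incidentSum b s i + incidentSum b′ s i
      ≡⟨ cong₂ (λ f f′ → sideSum b f + sideSum b′ f′) plain flipped ⟩
    sideSum b false + sideSum b′ true
      ≡⟨ sym (∑-distrib-+ {m} _ _) ⟩
    ∑[ j < m ] (suc (m * m * toℕ b + toℕ (cell s i j))
              + suc (m * m * toℕ b′ + toℕ (opposite (cell s i j))))
      ≡⟨ sum-cong-≗ (λ j → toℕ-opposite-complement (toℕ b) (toℕ b′) (cell s i j)) ⟩
    ∑[ j < m ] suc (m * m * suc (toℕ b + toℕ b′))
      ≡⟨ sum-const m _ ⟩
    m * suc (m * m * suc (toℕ b + toℕ b′)) ∎
    where
    open ≡-Reasoning
    sideSum : Fin 10 → Bool → ℕ
    sideSum b f = ∑[ j < m ] suc (m * m * toℕ b + toℕ (reflectIf f (cell s i j)))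

  partSum-complementary : ∀ {p p₁ p₂} i → Complementary p p₁ p₂ →
    partSum p i p₁ + partSum p i p₂ ≡
    m * suc (m * m * suc (toℕ (proj₁ (incidence p p₁)) + toℕ (proj₁ (incidence p p₂))))
  partSum-complementary {p} {p₁} {p₂} i (p≢p₁ , p≢p₂ , same-side , plain , flipped) = begin
    partSum p i p₁ + partSum p i p₂
      ≡⟨ cong₂ _+_ (partSum-≢ p p₁ i p≢p₁) (partSum-≢ p p₂ i p≢p₂) ⟩
    incidentSum b₁ s₁ i + incidentSum b₂ (proj₂ (incidence p p₂)) i
      ≡⟨ cong (λ s → incidentSum b₁ s₁ i + incidentSum b₂ s i) (sym same-side) ⟩
    incidentSum b₁ s₁ i + incidentSum b₂ s₁ i
      ≡⟨ incidentSum-complement b₁ b₂ s₁ i plain flipped ⟩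
    m * suc (m * m * suc (toℕ b₁ + toℕ b₂)) ∎
    where
    open ≡-Reasoning
    b₁ b₂ : Fin 10
    b₁ = proj₁ (incidence p p₁)
    b₂ = proj₁ (incidence p p₂)
    s₁ : Side
    s₁ = proj₂ (incidence p p₁)

  total : ℕ → ℕ
  total w = m * (2 + m * (m * (2 + w)))

  vsum-combine : ∀ p i → vsum graph labelling (combine p i) ≡ total (level p)
  vsum-combine p i = begin
    vsum graph labelling (combine p i)
      ≡⟨ vsum-sum graph labelling _ ⟩
    ∑[ v < 5 * m ] contrib graph labelling (combine p i) v
      ≡⟨ sum-combine 5 m _ ⟩
    ∑[ p′ < 5 ] partSum p i p′
      ≡⟨ sum-pairing p (partSum p i) ⟩
    partSum p i p + ((partSum p i p₁ + partSum p i p₂) + (partSum p i p₃ + partSum p i p₄))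
      ≡⟨ cong₂ _+_ (partSum-self p i)
           (cong₂ _+_ (partSum-complementary i complementary₁₂)
                      (partSum-complementary i complementary₃₄)) ⟩
    0 + (m * suc (m * m * suc w₁₂) + m * suc (m * m * suc w₃₄))
      ≡⟨ collect m w₁₂ w₃₄ ⟩
    total (w₁₂ + w₃₄) ∎
    where
    open ≡-Reasoning
    open Pairing (pairingAt p)
    w₁₂ w₃₄ : ℕ
    w₁₂ = toℕ (proj₁ (incidence p p₁)) + toℕ (proj₁ (incidence p p₂))
    w₃₄ = toℕ (proj₁ (incidence p p₃)) + toℕ (proj₁ (incidence p p₄))
    collect : ∀ m x y → 0 + (m * suc (m * m * suc x) + m * suc (m * m * suc y)) ≡
                        m * (2 + m * (m * (2 + (x + y))))
    collect = solve-∀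

  vsum-part : ∀ u → vsum graph labelling u ≡ total (level (part u))
  vsum-part u = trans (cong (vsum graph labelling) (sym (combine-part-index u))) (vsum-combine (part u) (index u))

  total-injective : ⦃ _ : NonZero m ⦄ → ∀ w w′ → total w ≡ total w′ → w ≡ w′
  total-injective w w′ eq =
    ℕP.+-cancelˡ-≡ 2 w w′ (ℕP.*-cancelˡ-≡ _ _ m (ℕP.*-cancelˡ-≡ _ _ m
      (ℕP.+-cancelˡ-≡ 2 _ _ (ℕP.*-cancelˡ-≡ _ _ m eq))))

  isLocalAntimagic : ⦃ _ : NonZero m ⦄ → IsLocalAntimagic graph labelling
  isLocalAntimagic u v adj eq = adjacent⇒≢ u v adj
    (level-injective _ _ (total-injective _ _ (trans (sym (vsum-part u)) (trans eq (vsum-part v)))))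

corollary3p18 : (N : ℕ) →
    Σ[ n ∈ ℕ ] Σ[ G ∈ Graph n ] Σ[ r ∈ ℕ ] Σ[ k ∈ ℕ ]
      (N ≤ n × N ≤ r × Regular G r × NonComplete G ×
       IsChromaticNumber G k × IsLocalAntimagicChromaticNumber G k)
corollary3p18 N =
  5 * m , graph , m * 4 , 5 ,
  ℕP.≤-trans N≤m (ℕP.m≤n*m m 5) , ℕP.≤-trans N≤m (ℕP.m≤m*n m 4) ,
  regular , nonComplete 0F 0F 1F (λ ()) ,
  isChromaticNumber graph (transversal 0F) (transversal-isClique 0F) part part-proper ,
  isLocalAntimagicChromaticNumber graph (transversal 0F) (transversal-isClique 0F)
    labelling isLocalAntimagic part (total ∘ level) vsum-part
  where
  m : ℕ
  m = suc (suc N)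
  open CompleteMultipartite 5 m
  open FivePartite m
  N≤m : N ≤ m
  N≤m = ℕP.m≤n+m N 2
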